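{- For every integer $n\geq 8$, $\sigma^{ - }(C_n^{3})=12$.
   Context: $C_n$ denotes the cycle on $n$ vertices $u_0,\dots,u_{n-1}$, and $C_n^3$ is its cube: the graph on the same vertices in which $u_i$ is adjacent to $u_{i\pm1}$, $u_{i\pm2}$ and $u_{i\pm3}$ (indices mod $n$). For a graph $G$ on $n$ vertices, the rna number $\sigma^{ - }(G)$ is the minimum, over all partitions $V(G)=A\cup B$ with $A\cap B=\emptyset$ and $||A|-|B||\leq 1$, of the number of edges of $G$ with one endpoint in $A$ and the other in $B$ (equivalently, the least number of negative edges among all parity signed graphs over $G$). -}

module Defs where

open import Data.Nat using (ℕ; zero; suc; _+_; _∸_; _≤_; _<ᵇ_; _≡ᵇ_)
open import Data.Nat.Base using (_⊓_)
open import Data.Bool using (Bool; true; false; _∧_; _∨_; not; if_then_else_)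
open import Data.Fin using (Fin; toℕ)
open import Data.List using (List; []; _∷_; length; allFin; concatMap; map)
open import Data.Product using (Σ; _×_; _,_)
import Data.Product
open import Relation.Binary.PropositionalEquality using (_≡_)

bfilter : {A : Set} → (A → Bool) → List A → List A
bfilter p [] = []
bfilter p (x ∷ xs) = if p x then x ∷ bfilter p xs else bfilter p xs

-- A (simple, loopless) graph on vertex set Fin n, given by a Boolean adjacency
-- relation (assumed symmetric and irreflexive for the graphs we use).
Graph : ℕ → Set
Graph n = Fin n → Fin n → Bool

absDiff : ℕ → ℕ → ℕ
absDiff a b = (a ∸ b) + (b ∸ a)

cycDist : (n : ℕ) → Fin n → Fin n → ℕ
cycDist n i j = absDiff (toℕ i) (toℕ j) ⊓ (n ∸ absDiff (toℕ i) (toℕ j))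

cycleCube : (n : ℕ) → Graph n
cycleCube n i j = (0 <ᵇ cycDist n i j) ∧ (cycDist n i j <ᵇ 4)

edges : {n : ℕ} → Graph n → List (Fin n × Fin n)
edges {n} G =
  concatMap (λ i → map (λ j → (i , j))
              (bfilter (λ j → (toℕ i <ᵇ toℕ j) ∧ G i j) (allFin n)))
            (allFin n)

-- A 2-partition V = A ∪ B, A ∩ B = ∅, encoded by its indicator: true ↦ A, false ↦ B.
Partition : ℕ → Set
Partition n = Fin n → Bool

sizeA : {n : ℕ} → Partition n → ℕ
sizeA {n} p = length (bfilter p (allFin n))

sizeB : {n : ℕ} → Partition n → ℕ
sizeB {n} p = length (bfilter (λ v → not (p v)) (allFin n))

Balanced : {n : ℕ} → Partition n → Set
Balanced p = absDiff (sizeA p) (sizeB p) ≤ 1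

xor : Bool → Bool → Bool
xor a b = if a then not b else b

cutSize : {n : ℕ} → Graph n → Partition n → ℕ
cutSize G p = length (bfilter (λ e → xor (p (Data.Product.proj₁ e)) (p (Data.Product.proj₂ e))) (edges G))

-- σ⁻(G) = k : k is the minimum of cutSize over balanced partitions
-- (attained by some balanced partition, and a lower bound for all of them).
RnaNumber : {n : ℕ} → Graph n → ℕ → Set
RnaNumber {n} G k =
  (Σ (Partition n) λ p → Balanced p × cutSize G p ≡ k)
  × ((p : Partition n) → Balanced p → k ≤ cutSize G p)

-- Reading u_0, …, u_{n-1} in order turns a partition into a binary word; the cut of C_n^3 is then
-- the cut of the cube of the path (letters at distance at most 3 along the word) plus six seam edges
-- joining the first three letters to the last three. The word 1^⌈n/2⌉ 0^⌊n/2⌋ cuts six edges of each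
-- kind. For the lower bound, prepending a letter to a word adds exactly its edges to the next three
-- letters, so a lower bound on the path-cube cut is certified by a potential on the finitely many
-- states (first three letters, last three letters, numbers of 1s and of 0s capped at 4), checked
-- state by state by evaluation; a final finite check shows that potential plus seam is at least 12
-- once both colours occur at least four times.

module Submission where

open import Data.Bool using (Bool; true; false; not; _∧_)
open import Data.Fin using (Fin; toℕ; fromℕ<) renaming (zero to fzero; suc to fsuc)
open import Data.Fin.Properties using (toℕ<n; fromℕ<-toℕ; toℕ-fromℕ<)
open import Data.List using (List; []; _∷_; _++_; replicate; map; take; length; concatMap; tabulate; allFin)
open import Data.List.Properties using (length-map; map-tabulate; map-cong; map-cong-local; map-++)
open import Data.List.Relation.Unary.All using (All; []; _∷_)
open import Data.Nat using (ℕ; zero; suc; _+_; _∸_; _≤_; _<_; _⊓_; _≤?_; _<?_; _≟_; _<ᵇ_; _≡ᵇ_; ⌈_/2⌉; ⌊_/2⌋; s≤s; z≤n; z<s)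
open import Data.Nat.ListAction using (sum)
open import Data.Nat.ListAction.Properties using (sum-++)
open import Data.Nat.Properties
open import Algebra.Properties.CommutativeSemigroup +-commutativeSemigroup using (interchange)
open import Data.Product using (_×_; _,_; proj₁; proj₂)
open import Data.Sum using (inj₁; inj₂)
open import Function using (id; _∘_)
open import Function.Bundles using (_⇔_; mk⇔)
open import Relation.Binary.Definitions using (tri<; tri≈; tri>)
open import Relation.Binary.PropositionalEquality
open import Relation.Nullary.Decidable using (Dec; yes; no; map′; toWitness; _×-dec_; dec-true; dec-false; does-⇔)
open import Relation.Nullary.Negation using (¬_; contradiction)

open import Defs

-- Binary words

bit : Bool → ℕ
bit true = 1
bit false = 0

differ : Bool → Bool → ℕ
differ x y = bit (xor x y)

pathCut : List Bool → ℕ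
pathCut [] = 0
pathCut (x ∷ ys) = sum (map (differ x) (take 3 ys)) + pathCut ys

Triple : Set
Triple = Bool × Bool × Bool

lastThree : Bool → Bool → Bool → List Bool → Triple
lastThree x y z [] = x , y , z
lastThree x y z (w ∷ ws) = lastThree y z w ws

-- Cut edges of C_n^3 that wrap around the cycle; (x, y, z) are the first three letters, (u, v, w) the last three.
seamCut : Triple → Triple → ℕ
seamCut (x , y , z) (u , v , w) =
  sum (map (differ x) (w ∷ v ∷ u ∷ [])) + (sum (map (differ y) (w ∷ v ∷ [])) + sum (map (differ z) (w ∷ [])))

cycleWordCut : List Bool → ℕ
cycleWordCut (x ∷ y ∷ z ∷ ws) = pathCut (x ∷ y ∷ z ∷ ws) + seamCut (x , y , z) (lastThree x y z ws)
cycleWordCut _ = 0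

trues falses : List Bool → ℕ
trues ws = length (bfilter (λ x → x) ws)
falses ws = length (bfilter not ws)

trues-∷ : ∀ x ws → trues (x ∷ ws) ≡ bit x + trues ws
trues-∷ true ws = refl
trues-∷ false ws = refl

falses-∷ : ∀ x ws → falses (x ∷ ws) ≡ bit (not x) + falses ws
falses-∷ true ws = refl
falses-∷ false ws = refl

trues+falses : ∀ ws → trues ws + falses ws ≡ length ws
trues+falses [] = refl
trues+falses (true ∷ ws) = cong suc (trues+falses ws)
trues+falses (false ∷ ws) = trans (+-suc (trues ws) (falses ws)) (cong suc (trues+falses ws))

-- Potentials found by computer search: pathCut-bound states what they mean, and nothing is used
-- about them beyond the three decidable checks that follow.
bound : Bool → Bool → Bool → Triple → ℕ → ℕ → ℕ
bound false false false (false , false , false) 0 3 = 0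
bound false false false (false , false , false) 0 4 = 0
bound false false false (false , false , false) 1 4 = 6
bound false false false (false , false , false) 2 4 = 10
bound false false false (false , false , true) 1 3 = 3
bound false false false (false , false , true) 1 4 = 3
bound false false false (false , false , true) 2 4 = 7
bound false false false (false , false , true) 3 4 = 11
bound false false false (false , true , false) 1 4 = 4
bound false false false (false , true , false) 2 4 = 8
bound false false false (false , true , false) 3 4 = 10
bound false false false (false , true , true) 2 3 = 5
bound false false false (false , true , true) 2 4 = 5
bound false false false (false , true , true) 3 4 = 7
bound false false false (false , true , true) 4 4 = 9
bound false false false (true , false , false) 1 4 = 5
bound false false false (true , false , false) 2 4 = 9
bound false false false (true , false , false) 3 4 = 11
bound false false false (true , false , false) 4 4 = 11
bound false false false (true , false , true) 2 4 = 6
bound false false false (true , false , true) 3 4 = 8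
bound false false false (true , false , true) 4 4 = 10
bound false false false (true , true , false) 2 4 = 7
bound false false false (true , true , false) 3 4 = 9
bound false false false (true , true , false) 4 4 = 9
bound false false false (true , true , true) 3 3 = 6
bound false false false (true , true , true) 3 4 = 6
bound false false false (true , true , true) 4 3 = 6
bound false false false (true , true , true) 4 4 = 6
bound false false true (false , false , false) 1 4 = 5
bound false false true (false , false , false) 2 4 = 9
bound false false true (false , false , false) 3 4 = 11
bound false false true (false , false , false) 4 4 = 11
bound false false true (false , false , true) 1 2 = 2
bound false false true (false , false , true) 2 4 = 6
bound false false true (false , false , true) 3 4 = 10
bound false false true (false , true , false) 1 3 = 3
bound false false true (false , true , false) 2 4 = 7
bound false false true (false , true , false) 3 4 = 9
bound false false true (false , true , false) 4 4 = 11
bound false false true (false , true , true) 2 2 = 4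
bound false false true (false , true , true) 3 3 = 6
bound false false true (false , true , true) 3 4 = 8
bound false false true (false , true , true) 4 3 = 8
bound false false true (false , true , true) 4 4 = 10
bound false false true (true , false , false) 1 4 = 4
bound false false true (true , false , false) 2 4 = 8
bound false false true (true , false , false) 3 4 = 10
bound false false true (true , false , false) 4 4 = 10
bound false false true (true , false , true) 2 3 = 5
bound false false true (true , false , true) 3 3 = 7
bound false false true (true , false , true) 3 4 = 9
bound false false true (true , false , true) 4 3 = 9
bound false false true (true , false , true) 4 4 = 9
bound false false true (true , true , false) 2 3 = 6
bound false false true (true , true , false) 3 3 = 8
bound false false true (true , true , false) 3 4 = 8
bound false false true (true , true , false) 4 3 = 8
bound false false true (true , true , false) 4 4 = 10
bound false false true (true , true , true) 3 2 = 5
bound false false true (true , true , true) 4 2 = 5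
bound false false true (true , true , true) 4 3 = 7
bound false false true (true , true , true) 4 4 = 9
bound false true false (false , false , false) 1 4 = 4
bound false true false (false , false , false) 2 4 = 8
bound false true false (false , false , false) 3 4 = 10
bound false true false (false , false , true) 2 3 = 5
bound false true false (false , false , true) 2 4 = 7
bound false true false (false , false , true) 3 4 = 9
bound false true false (false , false , true) 4 4 = 11
bound false true false (false , true , false) 1 2 = 2
bound false true false (false , true , false) 2 3 = 6
bound false true false (false , true , false) 2 4 = 6
bound false true false (false , true , false) 3 4 = 10
bound false true false (false , true , false) 4 4 = 10
bound false true false (false , true , true) 3 2 = 5
bound false true false (false , true , true) 3 3 = 7
bound false true false (false , true , true) 3 4 = 9
bound false true false (false , true , true) 4 3 = 9
bound false true false (false , true , true) 4 4 = 9
bound false true false (true , false , false) 1 3 = 3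
bound false true false (true , false , false) 2 4 = 7
bound false true false (true , false , false) 3 4 = 9
bound false true false (true , false , false) 4 4 = 11
bound false true false (true , false , true) 2 2 = 4
bound false true false (true , false , true) 3 3 = 8
bound false true false (true , false , true) 3 4 = 8
bound false true false (true , false , true) 4 3 = 8
bound false true false (true , false , true) 4 4 = 10
bound false true false (true , true , false) 3 3 = 7
bound false true false (true , true , false) 3 4 = 9
bound false true false (true , true , false) 4 3 = 9
bound false true false (true , true , false) 4 4 = 11
bound false true false (true , true , true) 4 2 = 6
bound false true false (true , true , true) 4 3 = 8
bound false true false (true , true , true) 4 4 = 10
bound false true true (false , false , false) 2 4 = 7
bound false true true (false , false , false) 3 4 = 9
bound false true true (false , false , false) 4 4 = 9
bound false true true (false , false , true) 3 3 = 8
bound false true true (false , false , true) 3 4 = 10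
bound false true true (false , false , true) 4 3 = 10
bound false true true (false , false , true) 4 4 = 10
bound false true true (false , true , false) 3 3 = 7
bound false true true (false , true , false) 3 4 = 9
bound false true true (false , true , false) 4 3 = 9
bound false true true (false , true , false) 4 4 = 11
bound false true true (false , true , true) 2 1 = 2
bound false true true (false , true , true) 4 2 = 6
bound false true true (false , true , true) 4 3 = 10
bound false true true (true , false , false) 2 3 = 6
bound false true true (true , false , false) 3 3 = 8
bound false true true (true , false , false) 3 4 = 8
bound false true true (true , false , false) 4 3 = 8
bound false true true (true , false , false) 4 4 = 10
bound false true true (true , false , true) 3 2 = 5
bound false true true (true , false , true) 4 2 = 7
bound false true true (true , false , true) 4 3 = 9
bound false true true (true , false , true) 4 4 = 11
bound false true true (true , true , false) 2 2 = 4
bound false true true (true , true , false) 3 2 = 6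
bound false true true (true , true , false) 4 2 = 6
bound false true true (true , true , false) 4 3 = 8
bound false true true (true , true , true) 3 1 = 3
bound false true true (true , true , true) 4 1 = 3
bound false true true (true , true , true) 4 2 = 7
bound false true true (true , true , true) 4 3 = 11
bound true false false (false , false , false) 1 3 = 3
bound true false false (false , false , false) 1 4 = 3
bound true false false (false , false , false) 2 4 = 7
bound true false false (false , false , false) 3 4 = 11
bound true false false (false , false , true) 2 2 = 4
bound true false false (false , false , true) 2 3 = 6
bound true false false (false , false , true) 2 4 = 6
bound true false false (false , false , true) 3 4 = 8
bound true false false (false , true , false) 2 3 = 5
bound true false false (false , true , false) 2 4 = 7
bound true false false (false , true , false) 3 4 = 9
bound true false false (false , true , false) 4 4 = 11
bound true false false (false , true , true) 3 2 = 6
bound true false false (false , true , true) 3 3 = 8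
bound true false false (false , true , true) 3 4 = 8
bound true false false (false , true , true) 4 3 = 8
bound true false false (false , true , true) 4 4 = 10
bound true false false (true , false , false) 1 2 = 2
bound true false false (true , false , false) 2 4 = 6
bound true false false (true , false , false) 3 4 = 10
bound true false false (true , false , true) 3 3 = 7
bound true false false (true , false , true) 3 4 = 9
bound true false false (true , false , true) 4 3 = 9
bound true false false (true , false , true) 4 4 = 11
bound true false false (true , true , false) 3 3 = 8
bound true false false (true , true , false) 3 4 = 10
bound true false false (true , true , false) 4 3 = 10
bound true false false (true , true , false) 4 4 = 10
bound true false false (true , true , true) 4 2 = 7
bound true false false (true , true , true) 4 3 = 9
bound true false false (true , true , true) 4 4 = 9
bound true false true (false , false , false) 2 4 = 6
bound true false true (false , false , false) 3 4 = 8
bound true false true (false , false , false) 4 4 = 10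
bound true false true (false , false , true) 3 3 = 7
bound true false true (false , false , true) 3 4 = 9
bound true false true (false , false , true) 4 3 = 9
bound true false true (false , false , true) 4 4 = 11
bound true false true (false , true , false) 2 2 = 4
bound true false true (false , true , false) 3 3 = 8
bound true false true (false , true , false) 3 4 = 8
bound true false true (false , true , false) 4 3 = 8
bound true false true (false , true , false) 4 4 = 10
bound true false true (false , true , true) 3 1 = 3
bound true false true (false , true , true) 4 2 = 7
bound true false true (false , true , true) 4 3 = 9
bound true false true (false , true , true) 4 4 = 11
bound true false true (true , false , false) 2 3 = 5
bound true false true (true , false , false) 3 3 = 7
bound true false true (true , false , false) 3 4 = 9
bound true false true (true , false , false) 4 3 = 9
bound true false true (true , false , false) 4 4 = 9
bound true false true (true , false , true) 2 1 = 2
bound true false true (true , false , true) 3 2 = 6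
bound true false true (true , false , true) 4 2 = 6
bound true false true (true , false , true) 4 3 = 10
bound true false true (true , false , true) 4 4 = 10
bound true false true (true , true , false) 3 2 = 5
bound true false true (true , true , false) 4 2 = 7
bound true false true (true , true , false) 4 3 = 9
bound true false true (true , true , false) 4 4 = 11
bound true false true (true , true , true) 4 1 = 4
bound true false true (true , true , true) 4 2 = 8
bound true false true (true , true , true) 4 3 = 10
bound true true false (false , false , false) 2 3 = 5
bound true true false (false , false , false) 2 4 = 5
bound true true false (false , false , false) 3 4 = 7
bound true true false (false , false , false) 4 4 = 9
bound true true false (false , false , true) 3 2 = 6
bound true true false (false , false , true) 3 3 = 8
bound true true false (false , false , true) 3 4 = 8
bound true true false (false , false , true) 4 3 = 8
bound true true false (false , false , true) 4 4 = 10
bound true true false (false , true , false) 3 2 = 5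
bound true true false (false , true , false) 3 3 = 7
bound true true false (false , true , false) 3 4 = 9
bound true true false (false , true , false) 4 3 = 9
bound true true false (false , true , false) 4 4 = 9
bound true true false (false , true , true) 4 1 = 4
bound true true false (false , true , true) 4 2 = 8
bound true true false (false , true , true) 4 3 = 10
bound true true false (false , true , true) 4 4 = 10
bound true true false (true , false , false) 2 2 = 4
bound true true false (true , false , false) 3 3 = 6
bound true true false (true , false , false) 3 4 = 8
bound true true false (true , false , false) 4 3 = 8
bound true true false (true , false , false) 4 4 = 10
bound true true false (true , false , true) 3 1 = 3
bound true true false (true , false , true) 4 2 = 7
bound true true false (true , false , true) 4 3 = 9
bound true true false (true , false , true) 4 4 = 11
bound true true false (true , true , false) 2 1 = 2
bound true true false (true , true , false) 4 2 = 6
bound true true false (true , true , false) 4 3 = 10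
bound true true false (true , true , true) 4 1 = 5
bound true true false (true , true , true) 4 2 = 9
bound true true false (true , true , true) 4 3 = 11
bound true true false (true , true , true) 4 4 = 11
bound true true true (false , false , false) 3 3 = 6
bound true true true (false , false , false) 3 4 = 6
bound true true true (false , false , false) 4 3 = 6
bound true true true (false , false , false) 4 4 = 6
bound true true true (false , false , true) 4 2 = 7
bound true true true (false , false , true) 4 3 = 9
bound true true true (false , false , true) 4 4 = 9
bound true true true (false , true , false) 4 2 = 6
bound true true true (false , true , false) 4 3 = 8
bound true true true (false , true , false) 4 4 = 10
bound true true true (false , true , true) 4 1 = 5
bound true true true (false , true , true) 4 2 = 9
bound true true true (false , true , true) 4 3 = 11
bound true true true (false , true , true) 4 4 = 11
bound true true true (true , false , false) 3 2 = 5
bound true true true (true , false , false) 4 2 = 5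
bound true true true (true , false , false) 4 3 = 7
bound true true true (true , false , false) 4 4 = 9
bound true true true (true , false , true) 4 1 = 4
bound true true true (true , false , true) 4 2 = 8
bound true true true (true , false , true) 4 3 = 10
bound true true true (true , true , false) 3 1 = 3
bound true true true (true , true , false) 4 1 = 3
bound true true true (true , true , false) 4 2 = 7
bound true true true (true , true , false) 4 3 = 11
bound true true true (true , true , true) 3 0 = 0
bound true true true (true , true , true) 4 0 = 0
bound true true true (true , true , true) 4 1 = 6
bound true true true (true , true , true) 4 2 = 10
bound _ _ _ _ _ _ = 12

∀-Bool? : {P : Bool → Set} → ((b : Bool) → Dec (P b)) → Dec ((b : Bool) → P b)
∀-Bool? P? = map′ (λ (pt , pf) → λ { true → pt ; false → pf }) (λ h → h true , h false) (P? true ×-dec P? false)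

∀-Triple? : {P : Triple → Set} → ((t : Triple) → Dec (P t)) → Dec ((t : Triple) → P t)
∀-Triple? P? = map′ (λ h (a , b , c) → h a b c) (λ h a b c → h (a , b , c))
  (∀-Bool? λ a → ∀-Bool? λ b → ∀-Bool? λ c → P? (a , b , c))

bound-step : ∀ x y z w L {ca} → ca < 5 → ∀ {cb} → cb < 5 →
  bound x y z L ((bit x + ca) ⊓ 4) ((bit (not x) + cb) ⊓ 4) ≤ sum (map (differ x) (y ∷ z ∷ w ∷ [])) + bound y z w L ca cb
bound-step = toWitness {a? = ∀-Bool? λ x → ∀-Bool? λ y → ∀-Bool? λ z → ∀-Bool? λ w → ∀-Triple? λ L →
  allUpTo? (λ ca → allUpTo? (λ cb → _ ≤? _) 5) 5} _

bound-base : ∀ x y z → bound x y z (x , y , z) (trues (x ∷ y ∷ z ∷ []) ⊓ 4) (falses (x ∷ y ∷ z ∷ []) ⊓ 4)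
                       ≤ pathCut (x ∷ y ∷ z ∷ [])
bound-base = toWitness {a? = ∀-Bool? λ x → ∀-Bool? λ y → ∀-Bool? λ z → _ ≤? _} _

bound-seam : ∀ x y z L → 12 ≤ bound x y z L 4 4 + seamCut (x , y , z) L
bound-seam = toWitness {a? = ∀-Bool? λ x → ∀-Bool? λ y → ∀-Bool? λ z → ∀-Triple? λ L → _ ≤? _} _

+-⊓-absorb : ∀ k c m → (k + c) ⊓ m ≡ (k + c ⊓ m) ⊓ m
+-⊓-absorb k c m = sym (begin
  (k + c ⊓ m) ⊓ m          ≡⟨ cong (_⊓ m) (+-distribˡ-⊓ k c m) ⟩
  ((k + c) ⊓ (k + m)) ⊓ m  ≡⟨ ⊓-assoc (k + c) (k + m) m ⟩
  (k + c) ⊓ ((k + m) ⊓ m)  ≡⟨ cong ((k + c) ⊓_) (m≥n⇒m⊓n≡n (m≤n+m m k)) ⟩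
  (k + c) ⊓ m              ∎)
  where open ≡-Reasoning

pathCut-bound : ∀ x y z ws →
  bound x y z (lastThree x y z ws) (trues (x ∷ y ∷ z ∷ ws) ⊓ 4) (falses (x ∷ y ∷ z ∷ ws) ⊓ 4)
  ≤ pathCut (x ∷ y ∷ z ∷ ws)
pathCut-bound x y z [] = bound-base x y z
pathCut-bound x y z (w ∷ ws) = begin
  bound x y z L (trues (x ∷ us) ⊓ 4) (falses (x ∷ us) ⊓ 4)
    ≡⟨ cong₂ (bound x y z L)
         (trans (cong (_⊓ 4) (trues-∷ x us)) (+-⊓-absorb (bit x) (trues us) 4))
         (trans (cong (_⊓ 4) (falses-∷ x us)) (+-⊓-absorb (bit (not x)) (falses us) 4)) ⟩
  bound x y z L ((bit x + trues us ⊓ 4) ⊓ 4) ((bit (not x) + falses us ⊓ 4) ⊓ 4)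
    ≤⟨ bound-step x y z w L (s≤s (m⊓n≤n (trues us) 4)) (s≤s (m⊓n≤n (falses us) 4)) ⟩
  sum (map (differ x) (take 3 us)) + bound y z w L (trues us ⊓ 4) (falses us ⊓ 4)
    ≤⟨ +-monoʳ-≤ _ (pathCut-bound y z w ws) ⟩
  pathCut (x ∷ us) ∎
  where
  open ≤-Reasoning
  us = y ∷ z ∷ w ∷ ws
  L = lastThree y z w ws

12≤cycleWordCut : ∀ x y z ws → 4 ≤ trues (x ∷ y ∷ z ∷ ws) → 4 ≤ falses (x ∷ y ∷ z ∷ ws) →
  12 ≤ cycleWordCut (x ∷ y ∷ z ∷ ws)
12≤cycleWordCut x y z ws 4≤t 4≤f = begin
  12                                            ≤⟨ bound-seam x y z L ⟩
  bound x y z L 4 4 + seamCut (x , y , z) L     ≡⟨ cong₂ (λ a b → bound x y z L a b + seamCut (x , y , z) L)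
                                                     (sym (m≥n⇒m⊓n≡n 4≤t)) (sym (m≥n⇒m⊓n≡n 4≤f)) ⟩
  bound x y z L (trues w ⊓ 4) (falses w ⊓ 4) + seamCut (x , y , z) L
                                                ≤⟨ +-monoˡ-≤ _ (pathCut-bound x y z ws) ⟩
  pathCut w + seamCut (x , y , z) L              ∎
  where
  open ≤-Reasoning
  w = x ∷ y ∷ z ∷ ws
  L = lastThree x y z ws

-- The balanced threshold word

differ-self : ∀ x → differ x x ≡ 0
differ-self true = refl
differ-self false = refl

pathCut-replicate : ∀ k x → pathCut (replicate k x) ≡ 0
pathCut-replicate zero x = refl
pathCut-replicate (suc k) x = cong₂ _+_ (window k) (pathCut-replicate k x)
  where
  window : ∀ k → sum (map (differ x) (take 3 (replicate k x))) ≡ 0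
  window 0 = refl
  window 1 rewrite differ-self x = refl
  window 2 rewrite differ-self x = refl
  window (suc (suc (suc k))) rewrite differ-self x = refl

pathCut-replicate-++ : ∀ k x ws → pathCut (replicate (3 + k) x ++ ws) ≡ pathCut (replicate 3 x ++ ws)
pathCut-replicate-++ zero x ws = refl
pathCut-replicate-++ (suc k) x ws = cong₂ _+_ (constant-window x) (pathCut-replicate-++ k x ws)
  where
  constant-window : ∀ x → sum (map (differ x) (x ∷ x ∷ x ∷ [])) ≡ 0
  constant-window true = refl
  constant-window false = refl

lastThree-++ : ∀ x y z ws u v w vs → lastThree x y z (ws ++ u ∷ v ∷ w ∷ vs) ≡ lastThree u v w vs
lastThree-++ x y z [] u v w vs = refl
lastThree-++ x y z (a ∷ ws) u v w vs = lastThree-++ y z a ws u v w vs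

lastThree-replicate : ∀ k x → lastThree x x x (replicate k x) ≡ (x , x , x)
lastThree-replicate zero x = refl
lastThree-replicate (suc k) x = lastThree-replicate k x

cycleWordCut-threshold : ∀ h r → cycleWordCut (replicate (4 + h) true ++ replicate (4 + r) false) ≡ 12
cycleWordCut-threshold h r = cong₂ _+_
  (trans (pathCut-replicate-++ (1 + h) true _) (cong (6 +_) (pathCut-replicate (4 + r) false)))
  (cong (seamCut (true , true , true))
    (trans (lastThree-++ true true true (replicate (1 + h) true) false false false (replicate (1 + r) false))
           (lastThree-replicate (1 + r) false)))

trues-threshold : ∀ H R → trues (replicate H true ++ replicate R false) ≡ H
trues-threshold zero R = no-trues R
  where
  no-trues : ∀ R → trues (replicate R false) ≡ 0
  no-trues zero = refl
  no-trues (suc R) = no-trues R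
trues-threshold (suc H) R = cong suc (trues-threshold H R)

falses-threshold : ∀ H R → falses (replicate H true ++ replicate R false) ≡ R
falses-threshold zero R = all-falses R
  where
  all-falses : ∀ R → falses (replicate R false) ≡ R
  all-falses zero = refl
  all-falses (suc R) = cong suc (all-falses R)
falses-threshold (suc H) R = falses-threshold H R

length-bfilter-++ : ∀ {A : Set} (P : A → Bool) xs ys →
  length (bfilter P (xs ++ ys)) ≡ length (bfilter P xs) + length (bfilter P ys)
length-bfilter-++ P [] ys = refl
length-bfilter-++ P (x ∷ xs) ys with P x
... | true = cong suc (length-bfilter-++ P xs ys)
... | false = length-bfilter-++ P xs ys

length-bfilter-concatMap : ∀ {A B : Set} (P : B → Bool) (f : A → List B) xs →
  length (bfilter P (concatMap f xs)) ≡ sum (map (λ x → length (bfilter P (f x))) xs)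
length-bfilter-concatMap P f [] = refl
length-bfilter-concatMap P f (x ∷ xs) =
  trans (length-bfilter-++ P (f x) (concatMap f xs)) (cong (_ +_) (length-bfilter-concatMap P f xs))

length-bfilter-map : ∀ {A B : Set} (P : B → Bool) (f : A → B) xs →
  length (bfilter P (map f xs)) ≡ length (bfilter (λ x → P (f x)) xs)
length-bfilter-map P f [] = refl
length-bfilter-map P f (x ∷ xs) with P (f x)
... | true = cong suc (length-bfilter-map P f xs)
... | false = length-bfilter-map P f xs

length-bfilter-bfilter : ∀ {A : Set} (P Q : A → Bool) xs →
  length (bfilter Q (bfilter P xs)) ≡ length (bfilter (λ x → P x ∧ Q x) xs)
length-bfilter-bfilter P Q [] = refl
length-bfilter-bfilter P Q (x ∷ xs) with P x
... | false = length-bfilter-bfilter P Q xs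
... | true with Q x
...   | true = cong suc (length-bfilter-bfilter P Q xs)
...   | false = length-bfilter-bfilter P Q xs

length-bfilter≡sum : ∀ {A : Set} (P : A → Bool) xs → length (bfilter P xs) ≡ sum (map (λ x → bit (P x)) xs)
length-bfilter≡sum P [] = refl
length-bfilter≡sum P (x ∷ xs) with P x
... | true = cong suc (length-bfilter≡sum P xs)
... | false = length-bfilter≡sum P xs

sum-map-+ : ∀ {A : Set} (f g : A → ℕ) xs → sum (map (λ x → f x + g x) xs) ≡ sum (map f xs) + sum (map g xs)
sum-map-+ f g [] = refl
sum-map-+ f g (x ∷ xs) = trans (cong (f x + g x +_) (sum-map-+ f g xs)) (interchange (f x) (g x) _ _)

sum-map-0 : ∀ {A : Set} (xs : List A) → sum (map (λ _ → 0) xs) ≡ 0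
sum-map-0 [] = refl
sum-map-0 (x ∷ xs) = sum-map-0 xs

sum-map-swap : ∀ {A B : Set} (g : A → B → ℕ) xs ys →
  sum (map (λ x → sum (map (g x) ys)) xs) ≡ sum (map (λ y → sum (map (λ x → g x y) xs)) ys)
sum-map-swap g [] ys = sym (sum-map-0 ys)
sum-map-swap g (x ∷ xs) ys =
  trans (cong (sum (map (g x) ys) +_) (sum-map-swap g xs ys)) (sym (sum-map-+ (g x) _ ys))

range : ℕ → ℕ → List ℕ
range s zero = []
range s (suc r) = s ∷ range (suc s) r

range-++ : ∀ s k r → range s (k + r) ≡ range s k ++ range (s + k) r
range-++ s zero r = cong (λ t → range t r) (sym (+-identityʳ s))
range-++ s (suc k) r = cong (s ∷_) (trans (range-++ (suc s) k r) (cong (λ t → range (suc s) k ++ range t r) (sym (+-suc s k))))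

range-snoc : ∀ s r → range s (suc r) ≡ range s r ++ (s + r) ∷ []
range-snoc s r = trans (cong (range s) (+-comm 1 r)) (range-++ s r 1)

length-range : ∀ s r → length (range s r) ≡ r
length-range s zero = refl
length-range s (suc r) = cong suc (length-range (suc s) r)

map-cong-range : ∀ {A : Set} {f g : ℕ → A} s r → (∀ b → s ≤ b → b < s + r → f b ≡ g b) →
  map f (range s r) ≡ map g (range s r)
map-cong-range s zero h = refl
map-cong-range s (suc r) h = cong₂ _∷_ (h s ≤-refl (m<m+n s z<s))
  (map-cong-range (suc s) r λ b s<b b<s+1+r → h b (<⇒≤ s<b) (subst (b <_) (sym (+-suc s r)) b<s+1+r))

map-const-range : ∀ {A : Set} (x : A) s k → map (λ _ → x) (range s k) ≡ replicate k x
map-const-range x s zero = refl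
map-const-range x s (suc k) = cong (x ∷_) (map-const-range x (suc s) k)

tabulate-range : ∀ {A : Set} {n} (f : Fin n → A) (g : ℕ → A) s →
  (∀ i → f i ≡ g (s + toℕ i)) → tabulate f ≡ map g (range s n)
tabulate-range {n = zero} f g s h = refl
tabulate-range {n = suc n} f g s h = cong₂ _∷_ (trans (h fzero) (cong g (+-identityʳ s)))
  (tabulate-range (f ∘ fsuc) g (suc s) λ i → trans (h (fsuc i)) (cong g (+-suc s (toℕ i))))

map-allFin-range : ∀ {A : Set} {n} (f : Fin n → A) (g : ℕ → A) →
  (∀ i → f i ≡ g (toℕ i)) → map f (allFin n) ≡ map g (range 0 n)
map-allFin-range f g h = trans (map-tabulate id f) (tabulate-range f g 0 h)

<ᵇ-true : ∀ {m n} → m < n → (m <ᵇ n) ≡ true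
<ᵇ-true {m} {n} = dec-true (m <? n)

<ᵇ-false : ∀ {m n} → ¬ m < n → (m <ᵇ n) ≡ false
<ᵇ-false {m} {n} = dec-false (m <? n)

<ᵇ-cong : ∀ {m n m′ n′} → (m < n ⇔ m′ < n′) → (m <ᵇ n) ≡ (m′ <ᵇ n′)
<ᵇ-cong {m} {n} {m′} {n′} h = does-⇔ h (m <? n) (m′ <? n′)

+-<ᵇ-cancelʳ : ∀ k j s → (k + s <ᵇ j + s) ≡ (k <ᵇ j)
+-<ᵇ-cancelʳ k j s = <ᵇ-cong (mk⇔ (+-cancelʳ-< s k j) (+-monoˡ-< s))

≡ᵇ-cong : ∀ {m n m′ n′} → (m ≡ n ⇔ m′ ≡ n′) → (m ≡ᵇ n) ≡ (m′ ≡ᵇ n′)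
≡ᵇ-cong {m} {n} {m′} {n′} h = does-⇔ h (m ≟ n) (m′ ≟ n′)

-- Neighbourhoods in C_n^3

steps : List ℕ
steps = 1 ∷ 2 ∷ 3 ∷ []

hits : ℕ → Bool → List ℕ → ℕ
hits b X ts = sum (map (λ t → bit ((b ≡ᵇ t) ∧ X)) ts)

window-hits : ∀ d X → bit (((0 <ᵇ d) ∧ (d <ᵇ 4)) ∧ X) ≡ hits d X steps
window-hits 0 X = refl
window-hits 1 X = sym (+-identityʳ _)
window-hits 2 X = sym (+-identityʳ _)
window-hits 3 X = sym (+-identityʳ _)
window-hits (suc (suc (suc (suc d)))) X = refl

hits-steps-far : ∀ {u} X → 4 ≤ u → hits u X steps ≡ 0
hits-steps-far X (s≤s (s≤s (s≤s (s≤s _)))) = refl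

m≤n∧8≤m+n⇒4≤n : ∀ {d u} → d ≤ u → 8 ≤ d + u → 4 ≤ u
m≤n∧8≤m+n⇒4≤n {d} {u} d≤u 8≤d+u with 4 ≤? u
... | yes 4≤u = 4≤u
... | no 4≰u = contradiction 8≤d+u (<⇒≱ (+-mono-< (≤-<-trans d≤u (≰⇒> 4≰u)) (≰⇒> 4≰u)))

⊓-window-hits : ∀ d u X → 8 ≤ d + u → bit (((0 <ᵇ d ⊓ u) ∧ (d ⊓ u <ᵇ 4)) ∧ X) ≡ hits d X steps + hits u X steps
⊓-window-hits d u X 8≤d+u with ≤-total d u
... | inj₁ d≤u rewrite m≤n⇒m⊓n≡m d≤u | hits-steps-far X (m≤n∧8≤m+n⇒4≤n d≤u 8≤d+u) =
  trans (window-hits d X) (sym (+-identityʳ _))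
... | inj₂ u≤d rewrite m≥n⇒m⊓n≡n u≤d | hits-steps-far X (m≤n∧8≤m+n⇒4≤n u≤d (subst (8 ≤_) (+-comm d u) 8≤d+u)) =
  window-hits u X

cyc : ℕ → ℕ → ℕ → ℕ
cyc n a b = absDiff a b ⊓ (n ∸ absDiff a b)

cubeAdj : ℕ → ℕ → ℕ → Bool
cubeAdj n a b = (0 <ᵇ cyc n a b) ∧ (cyc n a b <ᵇ 4)

forwardTargets : ℕ → List ℕ
forwardTargets a = map (_+ a) steps

backwardTargets : ℕ → ℕ → List ℕ
backwardTargets n a = map (λ k → a + (n ∸ k)) steps

hits-above : ∀ {a b} X {ts} → b ≤ a → All (a <_) ts → hits b X ts ≡ 0
hits-above X b≤a [] = refl
hits-above {b = b} X {t ∷ _} b≤a (a<t ∷ a<ts)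
  rewrite dec-false (b ≟ t) (<⇒≢ (≤-<-trans b≤a a<t)) = hits-above X b≤a a<ts

absDiff-+ : ∀ a d → absDiff a (a + d) ≡ d
absDiff-+ a d = cong₂ _+_ (m≤n⇒m∸n≡0 (m≤m+n a d)) (m+n∸m≡n a d)

cubeAdj-shift : ∀ n a d X → 8 ≤ n → a + d < n → 0 < d →
  bit (((a <ᵇ a + d) ∧ cubeAdj n a (a + d)) ∧ X) ≡ hits (a + d) X (forwardTargets a) + hits (a + d) X (backwardTargets n a)
cubeAdj-shift n a d X 8≤n a+d<n 0<d = begin
  bit (((a <ᵇ a + d) ∧ cubeAdj n a (a + d)) ∧ X)
    ≡⟨ cong (λ β → bit ((β ∧ cubeAdj n a (a + d)) ∧ X)) (<ᵇ-true (m<m+n a 0<d)) ⟩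
  bit (cubeAdj n a (a + d) ∧ X)
    ≡⟨ cong (λ e → bit (((0 <ᵇ e ⊓ (n ∸ e)) ∧ (e ⊓ (n ∸ e) <ᵇ 4)) ∧ X)) (absDiff-+ a d) ⟩
  bit (((0 <ᵇ d ⊓ (n ∸ d)) ∧ (d ⊓ (n ∸ d) <ᵇ 4)) ∧ X)
    ≡⟨ ⊓-window-hits d (n ∸ d) X (subst (8 ≤_) (sym (m+[n∸m]≡n d≤n)) 8≤n) ⟩
  hits d X steps + hits (n ∸ d) X steps
    ≡⟨ cong₂ _+_ (cong sum (map-cong-local {f = λ k → bit ((d ≡ᵇ k) ∧ X)} {g = λ k → bit ((a + d ≡ᵇ k + a) ∧ X)}
                              (fwd 1 ∷ fwd 2 ∷ fwd 3 ∷ [])))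
                 (cong sum (map-cong-local {f = λ k → bit ((n ∸ d ≡ᵇ k) ∧ X)} {g = λ k → bit ((a + d ≡ᵇ a + (n ∸ k)) ∧ X)}
                              (bwd 1 (k≤n 1 (s≤s z≤n)) ∷ bwd 2 (k≤n 2 (s≤s (s≤s z≤n))) ∷ bwd 3 (k≤n 3 ≤-refl) ∷ []))) ⟩
  hits (a + d) X (forwardTargets a) + hits (a + d) X (backwardTargets n a) ∎
  where
  open ≡-Reasoning
  d≤n : d ≤ n
  d≤n = ≤-trans (m≤n+m d a) (<⇒≤ a+d<n)
  k≤n : ∀ k → k ≤ 3 → k ≤ n
  k≤n k k≤3 = ≤-trans k≤3 (≤-trans (m≤m+n 3 5) 8≤n)
  fwd : ∀ k → bit ((d ≡ᵇ k) ∧ X) ≡ bit ((a + d ≡ᵇ k + a) ∧ X)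
  fwd k = cong (λ β → bit (β ∧ X)) (≡ᵇ-cong (mk⇔ (λ d≡k → trans (cong (a +_) d≡k) (+-comm a k))
                                                (λ e → +-cancelˡ-≡ a d k (trans e (+-comm k a)))))
  bwd : ∀ k → k ≤ n → bit ((n ∸ d ≡ᵇ k) ∧ X) ≡ bit ((a + d ≡ᵇ a + (n ∸ k)) ∧ X)
  bwd k k≤n′ = cong (λ β → bit (β ∧ X)) (≡ᵇ-cong (mk⇔
    (λ e → cong (a +_) (trans (sym (m∸[m∸n]≡n d≤n)) (cong (n ∸_) e)))
    (λ e → trans (cong (n ∸_) (+-cancelˡ-≡ a d (n ∸ k) e)) (m∸[m∸n]≡n k≤n′))))

cubeAdj-hits : ∀ n a b X → 8 ≤ n → b < n →
  bit (((a <ᵇ b) ∧ cubeAdj n a b) ∧ X) ≡ hits b X (forwardTargets a) + hits b X (backwardTargets n a)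
cubeAdj-hits n a b X 8≤n b<n with a <? b
... | yes a<b = shifted (b ∸ a) (m+[n∸m]≡n (<⇒≤ a<b)) b<n (m<n⇒0<n∸m a<b)
  where
  shifted : ∀ {b} d → a + d ≡ b → b < n → 0 < d →
    bit (((a <ᵇ b) ∧ cubeAdj n a b) ∧ X) ≡ hits b X (forwardTargets a) + hits b X (backwardTargets n a)
  shifted d refl = cubeAdj-shift n a d X 8≤n
... | no a≮b rewrite <ᵇ-false a≮b = sym (cong₂ _+_
  (hits-above X b≤a (m<n+m a z<s ∷ m<n+m a z<s ∷ m<n+m a z<s ∷ []))
  (hits-above X b≤a (n∸k>0 (s≤s (s≤s z≤n)) ∷ n∸k>0 (s≤s (s≤s (s≤s z≤n))) ∷ n∸k>0 (s≤s (s≤s (s≤s (s≤s z≤n)))) ∷ [])))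
  where
  b≤a : b ≤ a
  b≤a = ≮⇒≥ a≮b
  n∸k>0 : ∀ {k} → k < 8 → a < a + (n ∸ k)
  n∸k>0 k<8 = m<m+n a (m<n⇒0<n∸m (<-≤-trans k<8 8≤n))

hits-snoc : ∀ (F : ℕ → Bool) t n → bit ((t <ᵇ n) ∧ F t) + bit ((n ≡ᵇ t) ∧ F n) ≡ bit ((t <ᵇ suc n) ∧ F t)
hits-snoc F t n with <-cmp t n
... | tri< t<n _ _ rewrite <ᵇ-true t<n | <ᵇ-true (m<n⇒m<1+n t<n) | dec-false (n ≟ t) (≢-sym (<⇒≢ t<n)) =
  +-identityʳ _
... | tri≈ _ refl _ rewrite <ᵇ-false (n≮n t) | <ᵇ-true (n<1+n t) | dec-true (t ≟ t) refl = refl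
... | tri> _ _ n<t rewrite <ᵇ-false (<⇒≯ n<t) | <ᵇ-false (≤⇒≯ n<t) | dec-false (n ≟ t) (<⇒≢ n<t) = refl

hits-range : ∀ (F : ℕ → Bool) t n → sum (map (λ b → bit ((b ≡ᵇ t) ∧ F b)) (range 0 n)) ≡ bit ((t <ᵇ n) ∧ F t)
hits-range F t zero = refl
hits-range F t (suc n) = begin
  sum (map g (range 0 (suc n)))         ≡⟨ cong (sum ∘ map g) (range-snoc 0 n) ⟩
  sum (map g (range 0 n ++ n ∷ []))     ≡⟨ cong sum (map-++ g (range 0 n) (n ∷ [])) ⟩
  sum (map g (range 0 n) ++ g n ∷ [])   ≡⟨ sum-++ (map g (range 0 n)) (g n ∷ []) ⟩
  sum (map g (range 0 n)) + (g n + 0)   ≡⟨ cong₂ _+_ (hits-range F t n) (+-identityʳ (g n)) ⟩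
  bit ((t <ᵇ n) ∧ F t) + g n            ≡⟨ hits-snoc F t n ⟩
  bit ((t <ᵇ suc n) ∧ F t)              ∎
  where
  open ≡-Reasoning
  g : ℕ → ℕ
  g b = bit ((b ≡ᵇ t) ∧ F b)

crossings : ℕ → (ℕ → Bool) → ℕ → List ℕ → ℕ
crossings n c a ts = sum (map (λ t → bit ((t <ᵇ n) ∧ xor (c a) (c t))) ts)

row-crossings : ∀ n (c : ℕ → Bool) a → 8 ≤ n →
  sum (map (λ b → bit (((a <ᵇ b) ∧ cubeAdj n a b) ∧ xor (c a) (c b))) (range 0 n))
  ≡ crossings n c a (forwardTargets a) + crossings n c a (backwardTargets n a)
row-crossings n c a 8≤n = begin
  sum (map (λ b → bit (((a <ᵇ b) ∧ cubeAdj n a b) ∧ F b)) (range 0 n))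
    ≡⟨ cong sum (map-cong-range 0 n (λ b _ b<n → cubeAdj-hits n a b (F b) 8≤n b<n)) ⟩
  sum (map (λ b → hits b (F b) (forwardTargets a) + hits b (F b) (backwardTargets n a)) (range 0 n))
    ≡⟨ sum-map-+ (λ b → hits b (F b) (forwardTargets a)) (λ b → hits b (F b) (backwardTargets n a)) (range 0 n) ⟩
  sum (map (λ b → hits b (F b) (forwardTargets a)) (range 0 n)) + sum (map (λ b → hits b (F b) (backwardTargets n a)) (range 0 n))
    ≡⟨ cong₂ _+_ (hits-sum (forwardTargets a)) (hits-sum (backwardTargets n a)) ⟩
  crossings n c a (forwardTargets a) + crossings n c a (backwardTargets n a) ∎
  where
  open ≡-Reasoning
  F : ℕ → Bool
  F b = xor (c a) (c b)
  hits-sum : ∀ ts → sum (map (λ b → hits b (F b) ts) (range 0 n)) ≡ crossings n c a ts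
  hits-sum ts = trans (sum-map-swap (λ b t → bit ((b ≡ᵇ t) ∧ F b)) (range 0 n) ts)
                      (cong sum (map-cong (λ t → hits-range F t n) ts))

-- From partitions to words

cutSize≡sum : ∀ {n} (G : Graph n) (p : Partition n) →
  cutSize G p ≡ sum (map (λ i → sum (map (λ j → bit (((toℕ i <ᵇ toℕ j) ∧ G i j) ∧ xor (p i) (p j))) (allFin n))) (allFin n))
cutSize≡sum {n} G p = trans (length-bfilter-concatMap X row (allFin n)) (cong sum (map-cong row-sum (allFin n)))
  where
  X : Fin n × Fin n → Bool
  X (i , j) = xor (p i) (p j)
  E : Fin n → Fin n → Bool
  E i j = (toℕ i <ᵇ toℕ j) ∧ G i j
  row : Fin n → List (Fin n × Fin n)
  row i = map (i ,_) (bfilter (E i) (allFin n))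
  row-sum : ∀ i → length (bfilter X (row i)) ≡ sum (map (λ j → bit (E i j ∧ X (i , j))) (allFin n))
  row-sum i = trans (length-bfilter-map X (i ,_) (bfilter (E i) (allFin n)))
             (trans (length-bfilter-bfilter (E i) (λ j → X (i , j)) (allFin n))
                    (length-bfilter≡sum (λ j → E i j ∧ X (i , j)) (allFin n)))

colour : ∀ {n} → Partition n → ℕ → Bool
colour {n} p b with b <? n
... | yes b<n = p (fromℕ< b<n)
... | no _ = false

colour-< : ∀ {n} (p : Partition n) {b} (b<n : b < n) → colour p b ≡ p (fromℕ< b<n)
colour-< {n} p {b} b<n with b <? n
... | yes _ = refl
... | no b≮n = contradiction b<n b≮n

colour-toℕ : ∀ {n} (p : Partition n) i → colour p (toℕ i) ≡ p i
colour-toℕ p i = trans (colour-< p (toℕ<n i)) (cong p (fromℕ<-toℕ i (toℕ<n i)))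

cutSize-cycleCube≡crossings : ∀ n (p : Partition n) → 8 ≤ n →
  cutSize (cycleCube n) p ≡ sum (map (λ a → crossings n (colour p) a (forwardTargets a)) (range 0 n))
                          + sum (map (λ a → crossings n (colour p) a (backwardTargets n a)) (range 0 n))
cutSize-cycleCube≡crossings n p 8≤n = begin
  cutSize (cycleCube n) p
    ≡⟨ cutSize≡sum (cycleCube n) p ⟩
  sum (map (λ i → sum (map (finEdge i) (allFin n))) (allFin n))
    ≡⟨ cong sum (map-allFin-range (λ i → sum (map (finEdge i) (allFin n))) (λ a → sum (map (edge a) (range 0 n)))
         (λ i → cong sum (map-allFin-range (finEdge i) (edge (toℕ i)) (recolour i)))) ⟩
  sum (map (λ a → sum (map (edge a) (range 0 n))) (range 0 n))
    ≡⟨ cong sum (map-cong (λ a → row-crossings n c a 8≤n) (range 0 n)) ⟩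
  sum (map (λ a → crossings n c a (forwardTargets a) + crossings n c a (backwardTargets n a)) (range 0 n))
    ≡⟨ sum-map-+ (λ a → crossings n c a (forwardTargets a)) (λ a → crossings n c a (backwardTargets n a)) (range 0 n) ⟩
  sum (map (λ a → crossings n c a (forwardTargets a)) (range 0 n))
    + sum (map (λ a → crossings n c a (backwardTargets n a)) (range 0 n)) ∎
  where
  open ≡-Reasoning
  c = colour p
  edge : ℕ → ℕ → ℕ
  edge a b = bit (((a <ᵇ b) ∧ cubeAdj n a b) ∧ xor (c a) (c b))
  finEdge : Fin n → Fin n → ℕ
  finEdge i j = bit (((toℕ i <ᵇ toℕ j) ∧ cycleCube n i j) ∧ xor (p i) (p j))
  recolour : ∀ i j → finEdge i j ≡ edge (toℕ i) (toℕ j)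
  recolour i j = cong₂ (λ x y → bit (((toℕ i <ᵇ toℕ j) ∧ cycleCube n i j) ∧ xor x y)) (sym (colour-toℕ p i)) (sym (colour-toℕ p j))

window-crossings : ∀ (c : ℕ → Bool) s r →
  sum (map (differ (c s)) (take 3 (map c (range (suc s) r)))) ≡ crossings (s + suc r) c s (forwardTargets s)
window-crossings c s r = sym (begin
  crossings (s + suc r) c s (forwardTargets s)
    ≡⟨ cong sum (map-cong-local {f = λ k → bit ((k + s <ᵇ s + suc r) ∧ X k)} {g = λ k → bit ((k <ᵇ suc r) ∧ X k)}
                   (shift 1 ∷ shift 2 ∷ shift 3 ∷ [])) ⟩
  sum (map (λ k → bit ((k <ᵇ suc r) ∧ X k)) steps)
    ≡⟨ truncate r ⟩
  sum (map (differ (c s)) (take 3 (map c (range (suc s) r)))) ∎)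
  where
  open ≡-Reasoning
  X : ℕ → Bool
  X k = xor (c s) (c (k + s))
  shift : ∀ k → bit ((k + s <ᵇ s + suc r) ∧ X k) ≡ bit ((k <ᵇ suc r) ∧ X k)
  shift k = cong (λ β → bit (β ∧ X k)) (trans (cong (k + s <ᵇ_) (+-comm s (suc r))) (+-<ᵇ-cancelʳ k (suc r) s))
  truncate : ∀ r → sum (map (λ k → bit ((k <ᵇ suc r) ∧ X k)) steps)
                   ≡ sum (map (differ (c s)) (take 3 (map c (range (suc s) r))))
  truncate 0 = refl
  truncate 1 = refl
  truncate 2 = refl
  truncate (suc (suc (suc r))) = refl

pathCut-range : ∀ (c : ℕ → Bool) s r →
  pathCut (map c (range s r)) ≡ sum (map (λ a → crossings (s + r) c a (forwardTargets a)) (range s r))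
pathCut-range c s zero = refl
pathCut-range c s (suc r) = cong₂ _+_ (window-crossings c s r)
  (trans (pathCut-range c (suc s) r)
         (cong (λ N → sum (map (λ a → crossings N c a (forwardTargets a)) (range (suc s) r))) (sym (+-suc s r))))

lastThree-range : ∀ (c : ℕ → Bool) s k →
  lastThree (c s) (c (1 + s)) (c (2 + s)) (map c (range (3 + s) k)) ≡ (c (s + k) , c (s + suc k) , c (s + suc (suc k)))
lastThree-range c s zero rewrite +-identityʳ s | +-comm s 1 | +-comm s 2 = refl
lastThree-range c s (suc k) rewrite +-suc s k | +-suc s (suc k) | +-suc s (suc (suc k)) = lastThree-range c (suc s) k

seam-crossings : ∀ m (c : ℕ → Bool) →
  sum (map (λ a → crossings (8 + m) c a (backwardTargets (8 + m) a)) (range 0 (8 + m)))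
  ≡ seamCut (c 0 , c 1 , c 2) (c (5 + m) , c (6 + m) , c (7 + m))
seam-crossings m c = begin
  B 0 + (B 1 + (B 2 + sum (map B (range 3 (5 + m)))))
    ≡⟨ cong (λ z → B 0 + (B 1 + (B 2 + z))) (trans (cong sum (map-cong-range 3 (5 + m) far)) (sum-map-0 (range 3 (5 + m)))) ⟩
  B 0 + (B 1 + (B 2 + 0))
    ≡⟨ cong₂ _+_ (cong₂ _+_ (lands 7) (cong₂ _+_ (lands 6) (cong₂ _+_ (lands 5) refl)))
                 (cong₂ _+_ (cong₂ _+_ (lands 8) (cong₂ _+_ (lands 7) (cong₂ _+_ (lands 6) refl)))
                            (trans (+-identityʳ (B 2)) (cong₂ _+_ (lands 9) (cong₂ _+_ (lands 8) (cong₂ _+_ (lands 7) refl))))) ⟩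
  seamCut (c 0 , c 1 , c 2) (c (5 + m) , c (6 + m) , c (7 + m)) ∎
  where
  open ≡-Reasoning
  N = 8 + m
  B : ℕ → ℕ
  B a = crossings N c a (backwardTargets N a)
  lands : ∀ k {X} → bit ((k + m <ᵇ N) ∧ X) ≡ bit ((k <ᵇ 8) ∧ X)
  lands k {X} = cong (λ β → bit (β ∧ X)) (+-<ᵇ-cancelʳ k 8 m)
  far : ∀ a → 3 ≤ a → a < 3 + (5 + m) → B a ≡ 0
  far a 3≤a a<N = cong₂ _+_ (beyond 1 (≤-trans (s≤s z≤n) 3≤a))
                   (cong₂ _+_ (beyond 2 (≤-trans (s≤s (s≤s z≤n)) 3≤a)) (cong₂ _+_ (beyond 3 3≤a) refl))
    where
    beyond : ∀ k {X} → k ≤ a → bit ((a + (N ∸ k) <ᵇ N) ∧ X) ≡ 0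
    beyond k {X} k≤a = cong (λ β → bit (β ∧ X)) (<ᵇ-false λ lt → <⇒≱ lt
      (subst (_≤ a + (N ∸ k)) (m+[n∸m]≡n (≤-trans k≤a (<⇒≤ a<N))) (+-monoˡ-≤ (N ∸ k) k≤a)))

word : ∀ {n} → Partition n → List Bool
word {n} p = map (colour p) (range 0 n)

cutSize-cycleCube≡cycleWordCut : ∀ m (p : Partition (8 + m)) → cutSize (cycleCube (8 + m)) p ≡ cycleWordCut (word p)
cutSize-cycleCube≡cycleWordCut m p = trans (cutSize-cycleCube≡crossings (8 + m) p (m≤m+n 8 m))
  (cong₂ _+_ (sym (pathCut-range c 0 (8 + m)))
             (trans (seam-crossings m c) (cong (seamCut (c 0 , c 1 , c 2)) (sym (lastThree-range c 0 (5 + m))))))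
  where
  c = colour p

sizeA≡trues : ∀ {n} (p : Partition n) → sizeA p ≡ trues (word p)
sizeA≡trues {n} p = trans (sym (length-bfilter-map (λ x → x) p (allFin n)))
                          (cong trues (map-allFin-range p (colour p) (λ i → sym (colour-toℕ p i))))

sizeB≡falses : ∀ {n} (p : Partition n) → sizeB p ≡ falses (word p)
sizeB≡falses {n} p = trans (sym (length-bfilter-map not p (allFin n)))
                           (cong falses (map-allFin-range p (colour p) (λ i → sym (colour-toℕ p i))))

length-word : ∀ {n} (p : Partition n) → length (word p) ≡ n
length-word {n} p = trans (length-map (colour p) (range 0 n)) (length-range 0 n)

8≤m+n∧n∸m≤1⇒4≤m : ∀ {a b} → 8 ≤ a + b → b ∸ a ≤ 1 → 4 ≤ a
8≤m+n∧n∸m≤1⇒4≤m {a} {b} 8≤a+b b∸a≤1 with 4 ≤? a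
... | yes 4≤a = 4≤a
... | no 4≰a = contradiction 8≤a+b (<⇒≱ (s≤s (+-mono-≤ a≤3 b≤4)))
  where
  a≤3 : a ≤ 3
  a≤3 = ≤-pred (≰⇒> 4≰a)
  b≤4 : b ≤ 4
  b≤4 = ≤-trans (m≤n+m∸n b a) (+-mono-≤ a≤3 b∸a≤1)

sizeA+sizeB : ∀ {n} (p : Partition n) → sizeA p + sizeB p ≡ n
sizeA+sizeB p = trans (cong₂ _+_ (sizeA≡trues p) (sizeB≡falses p)) (trans (trues+falses (word p)) (length-word p))

balanced⇒4≤sizes : ∀ {n} (p : Partition n) → 8 ≤ n → Balanced p → 4 ≤ sizeA p × 4 ≤ sizeB p
balanced⇒4≤sizes p 8≤n balanced =
  8≤m+n∧n∸m≤1⇒4≤m 8≤A+B (≤-trans (m≤n+m (B ∸ A) (A ∸ B)) balanced) ,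
  8≤m+n∧n∸m≤1⇒4≤m (subst (8 ≤_) (+-comm A B) 8≤A+B) (≤-trans (m≤m+n (A ∸ B) (B ∸ A)) balanced)
  where
  A = sizeA p
  B = sizeB p
  8≤A+B : 8 ≤ A + B
  8≤A+B = subst (8 ≤_) (sym (sizeA+sizeB p)) 8≤n

12≤cutSize-cycleCube : ∀ m (p : Partition (8 + m)) → Balanced p → 12 ≤ cutSize (cycleCube (8 + m)) p
12≤cutSize-cycleCube m p balanced = subst (12 ≤_) (sym (cutSize-cycleCube≡cycleWordCut m p))
  (12≤cycleWordCut (colour p 0) (colour p 1) (colour p 2) (map (colour p) (range 3 (5 + m)))
    (subst (4 ≤_) (sizeA≡trues p) (proj₁ sides)) (subst (4 ≤_) (sizeB≡falses p) (proj₂ sides)))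
  where
  sides : 4 ≤ sizeA p × 4 ≤ sizeB p
  sides = balanced⇒4≤sizes p (m≤m+n 8 m) balanced

threshold-word : ∀ H R → map (_<ᵇ H) (range 0 (H + R)) ≡ replicate H true ++ replicate R false
threshold-word H R = begin
  map (_<ᵇ H) (range 0 (H + R))                       ≡⟨ cong (map (_<ᵇ H)) (range-++ 0 H R) ⟩
  map (_<ᵇ H) (range 0 H ++ range H R)                ≡⟨ map-++ (_<ᵇ H) (range 0 H) (range H R) ⟩
  map (_<ᵇ H) (range 0 H) ++ map (_<ᵇ H) (range H R)
    ≡⟨ cong₂ _++_ (trans (map-cong-range 0 H (λ b _ b<H → <ᵇ-true b<H)) (map-const-range true 0 H))
                  (trans (map-cong-range H R (λ b H≤b _ → <ᵇ-false (≤⇒≯ H≤b))) (map-const-range false H R)) ⟩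
  replicate H true ++ replicate R false               ∎
  where open ≡-Reasoning

halves : ∀ n → Partition n
halves n i = toℕ i <ᵇ ⌈ n /2⌉

word-halves : ∀ n → word (halves n) ≡ replicate ⌈ n /2⌉ true ++ replicate ⌊ n /2⌋ false
word-halves n = begin
  map (colour (halves n)) (range 0 n)
    ≡⟨ map-cong-range 0 n (λ b _ b<n → trans (colour-< (halves n) b<n) (cong (_<ᵇ ⌈ n /2⌉) (toℕ-fromℕ< b<n))) ⟩
  map (_<ᵇ ⌈ n /2⌉) (range 0 n)
    ≡⟨ cong (λ k → map (_<ᵇ ⌈ n /2⌉) (range 0 k)) (trans (sym (⌊n/2⌋+⌈n/2⌉≡n n)) (+-comm ⌊ n /2⌋ ⌈ n /2⌉)) ⟩
  map (_<ᵇ ⌈ n /2⌉) (range 0 (⌈ n /2⌉ + ⌊ n /2⌋))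
    ≡⟨ threshold-word ⌈ n /2⌉ ⌊ n /2⌋ ⟩
  replicate ⌈ n /2⌉ true ++ replicate ⌊ n /2⌋ false ∎
  where open ≡-Reasoning

⌈n/2⌉-⌊n/2⌋ : ∀ n → absDiff ⌈ n /2⌉ ⌊ n /2⌋ ≤ 1
⌈n/2⌉-⌊n/2⌋ zero = z≤n
⌈n/2⌉-⌊n/2⌋ (suc zero) = s≤s z≤n
⌈n/2⌉-⌊n/2⌋ (suc (suc n)) = ⌈n/2⌉-⌊n/2⌋ n

halves-balanced : ∀ n → Balanced (halves n)
halves-balanced n = subst₂ (λ a b → absDiff a b ≤ 1)
  (sym (trans (sizeA≡trues (halves n)) (trans (cong trues (word-halves n)) (trues-threshold ⌈ n /2⌉ ⌊ n /2⌋))))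
  (sym (trans (sizeB≡falses (halves n)) (trans (cong falses (word-halves n)) (falses-threshold ⌈ n /2⌉ ⌊ n /2⌋))))
  (⌈n/2⌉-⌊n/2⌋ n)

cutSize-cycleCube-halves : ∀ m → cutSize (cycleCube (8 + m)) (halves (8 + m)) ≡ 12
cutSize-cycleCube-halves m = begin
  cutSize (cycleCube (8 + m)) (halves (8 + m))   ≡⟨ cutSize-cycleCube≡cycleWordCut m (halves (8 + m)) ⟩
  cycleWordCut (word (halves (8 + m)))           ≡⟨ cong cycleWordCut (word-halves (8 + m)) ⟩
  cycleWordCut (replicate (4 + ⌈ m /2⌉) true ++ replicate (4 + ⌊ m /2⌋) false) ≡⟨ cycleWordCut-threshold ⌈ m /2⌉ ⌊ m /2⌋ ⟩
  12 ∎
  where open ≡-Reasoning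

theorem3p4 : (n : ℕ) → 8 ≤ n → RnaNumber (cycleCube n) 12
theorem3p4 n 8≤n with m≤n⇒∃[o]m+o≡n 8≤n
... | m , refl = (halves (8 + m) , halves-balanced (8 + m) , cutSize-cycleCube-halves m) , 12≤cutSize-cycleCube m
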